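{- Let $T$ be a tournament with $n$ vertices and $S$ its Seidel adjacency matrix. Then the sum of all $4\times 4$ principal minors of $S$ equals $8\,\delta_T+\binom{n}{4}$, where $\delta_T$ is the number of diamonds in $T$.
   Context: A tournament on vertices $v_1,\dots,v_n$ has adjacency matrix $A=(a_{ij})$ with $a_{ij}=1$ if $v_i$ dominates $v_j$ and $0$ otherwise; its Seidel adjacency matrix is $S=A-A^T$. A diamond is a 4-vertex tournament containing exactly one directed 3-cycle (equivalently, a vertex dominating, or dominated by, a 3-cycle); $\delta_T$ is the number of 4-element vertex subsets of $T$ inducing a diamond. -}

module Defs where

open import Data.Bool using (Bool; true; false; not; _∧_; _∨_; if_then_else_)
open import Data.Nat as ℕ using (ℕ; zero; suc)
open import Data.Integer as ℤ using (ℤ; +_; -_; _-_; _*_; _+_)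
open import Data.Fin using (Fin; zero; suc; punchIn; _<?_)
open import Data.List using (List; []; _∷_; concatMap; filter; length; map; sum; foldr)
open import Data.List using (allFin)
open import Data.Product using (_×_; _,_)
open import Relation.Binary.PropositionalEquality using (_≡_; _≢_)
open import Relation.Nullary.Decidable using (does)

record Tournament (n : ℕ) : Set where
  field
    dom     : Fin n → Fin n → Bool
    irrefl  : ∀ i → dom i i ≡ false
    antisym : ∀ i j → i ≢ j → dom j i ≡ not (dom i j)
open Tournament public

b2z : Bool → ℤ
b2z true  = + 1
b2z false = + 0

adj : ∀ {n} → Tournament n → Fin n → Fin n → ℤ
adj T i j = b2z (dom T i j)

seidel : ∀ {n} → Tournament n → Fin n → Fin n → ℤ
seidel T i j = adj T i j - adj T j i

ΣFin : ∀ n → (Fin n → ℤ) → ℤ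
ΣFin zero    f = + 0
ΣFin (suc n) f = f zero + ΣFin n (λ i → f (suc i))

sgn : ℕ → ℤ
sgn zero    = + 1
sgn (suc k) = - sgn k

det : ∀ n → (Fin n → Fin n → ℤ) → ℤ
det zero    M = + 1
det (suc n) M =
  ΣFin (suc n) (λ j → sgn (Data.Fin.toℕ j) * M zero j
                       * det n (λ r c → M (suc r) (punchIn j c)))

Quad : ℕ → Set
Quad n = Fin n × Fin n × Fin n × Fin n

quads : ∀ n → List (Quad n)
quads n =
  concatMap (λ i → concatMap (λ j → concatMap (λ k → concatMap (λ l →
      if does (i <? j) ∧ does (j <? k) ∧ does (k <? l)
      then (i , j , k , l) ∷ [] else [])
    (allFin n)) (allFin n)) (allFin n)) (allFin n)

qvert : ∀ {n} → Quad n → Fin 4 → Fin n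
qvert (i , j , k , l) zero = i
qvert (i , j , k , l) (suc zero) = j
qvert (i , j , k , l) (suc (suc zero)) = k
qvert (i , j , k , l) (suc (suc (suc zero))) = l

principalMinor4 : ∀ {n} → Tournament n → Quad n → ℤ
principalMinor4 T q = det 4 (λ r c → seidel T (qvert q r) (qvert q c))

sumPrincipalMinors4 : ∀ {n} → Tournament n → ℤ
sumPrincipalMinors4 {n} T = foldr _+_ (+ 0) (map (principalMinor4 T) (quads n))

cyclic : ∀ {n} → Tournament n → Fin n → Fin n → Fin n → Bool
cyclic T a b c =
  (dom T a b ∧ dom T b c ∧ dom T c a) ∨ (dom T a c ∧ dom T c b ∧ dom T b a)

bcount : Bool → ℕ
bcount true  = 1
bcount false = 0

threeCycles : ∀ {n} → Tournament n → Quad n → ℕ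
threeCycles T (i , j , k , l) =
  bcount (cyclic T i j k) ℕ.+ bcount (cyclic T i j l)
  ℕ.+ bcount (cyclic T i k l) ℕ.+ bcount (cyclic T j k l)

isDiamond : ∀ {n} → Tournament n → Quad n → Bool
isDiamond T q = does (threeCycles T q ℕ.≟ 1)

diamonds : ∀ {n} → Tournament n → ℕ
diamonds {n} T = foldr ℕ._+_ 0 (map (λ q → bcount (isDiamond T q)) (quads n))

-- A 4×4 principal minor of S only depends on the tournament induced on the
-- four vertices, i.e. on the orientations of its six edges; running through
-- all 64 orientations shows that the minor is 9 on a diamond and 1 otherwise.
-- Summing over the four-element subsets gives 8 δ_T + n C 4, where n C 4 is
-- reached by counting increasing chains by their least element (Pascal's rule).
module Submission where

open import Defs
open import Data.Nat using (ℕ)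
open import Data.Nat.Combinatorics using (_C_)
open import Data.Integer using (+_)
open import Relation.Binary.PropositionalEquality using (_≡_)

open import Data.Bool using (Bool; true; false; not; _∧_; _∨_; if_then_else_; T)
open import Data.Bool.Properties using (T-∧)
open import Data.Nat as ℕ using (zero; suc; _*_; _+_; s≤s)
import Data.Nat.Properties as ℕ
open import Data.Nat.Combinatorics using (nCk+nC[k+1]≡[n+1]C[k+1]; nC1≡n)
open import Data.Nat.Tactic.RingSolver using (solve-∀)
open import Data.Integer as ℤ using (ℤ; -1ℤ)
import Data.Integer.Properties as ℤ
open import Data.Fin using (Fin; zero; suc; _<_; _<?_; toℕ; punchIn)
open import Data.Fin.Properties using (<-cmp; <-trans; <⇒≢)
open import Data.List using (List; []; _∷_; concatMap; length; map; foldr; allFin; tabulate)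
open import Data.List.Properties using (length-++)
open import Data.List.Relation.Unary.All as All using (All; []; _∷_)
open import Data.List.Relation.Unary.All.Properties using (concat⁺; map⁺)
open import Data.Product using (_×_; _,_)
open import Data.Unit using (tt)
open import Algebra.Properties.Semiring.Sum ℕ.+-*-semiring using (sum; sum-cong-≗; *-distribˡ-sum)
open import Relation.Binary.Definitions using (tri<; tri≈; tri>)
open import Relation.Binary.PropositionalEquality
  using (refl; sym; trans; cong; cong₂; _≢_; module ≡-Reasoning)
open import Relation.Nullary using (Dec; map′; _×-dec_; does)
open import Relation.Nullary.Decidable using (from-yes)
open import Function.Bundles using (Equivalence)

open ≡-Reasoning

private
  variable
    m n : ℕ

lt : Fin n → Fin n → Bool
lt i j = does (i <? j)

lt⇒< : (i j : Fin n) → T (lt i j) → i < j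
lt⇒< i j = ℕ.<ᵇ⇒< (toℕ i) (toℕ j)

chainsFrom : ℕ → (n : ℕ) → Fin n → ℕ
chainsFrom zero    n x = 1
chainsFrom (suc m) n x = sum λ y → bcount (lt x y) * chainsFrom m n y

chains : ℕ → ℕ → ℕ
chains m n = sum (chainsFrom m n)

chainsFrom-suc : ∀ m n x → chainsFrom m (suc n) (suc x) ≡ chainsFrom m n x
chainsFrom-suc zero    n x = refl
chainsFrom-suc (suc m) n x =
  sum-cong-≗ λ y → cong (bcount (lt x y) *_) (chainsFrom-suc m n y)

chainsFrom-zero : ∀ m n → chainsFrom (suc m) (suc n) zero ≡ chains m n
chainsFrom-zero m n = sum-cong-≗ λ y → trans (ℕ.*-identityˡ _) (chainsFrom-suc m n y)

chains-suc : ∀ m n → chains m (suc n) ≡ chainsFrom m (suc n) zero + chains m n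
chains-suc m n = cong (_+_ (chainsFrom m (suc n) zero)) (sum-cong-≗ (chainsFrom-suc m n))

chains-zero : ∀ n → chains 0 n ≡ n
chains-zero zero    = refl
chains-zero (suc n) = cong suc (chains-zero n)

chains≡C : ∀ m n → chains m n ≡ n C suc m
chains≡C zero    n       = trans (chains-zero n) (sym (nC1≡n n))
chains≡C (suc m) zero    = refl
chains≡C (suc m) (suc n) = begin
  chains (suc m) (suc n)
    ≡⟨ chains-suc (suc m) n ⟩
  chainsFrom (suc m) (suc n) zero + chains (suc m) n
    ≡⟨ cong₂ _+_ (trans (chainsFrom-zero m n) (chains≡C m n)) (chains≡C (suc m) n) ⟩
  n C suc m + n C suc (suc m)
    ≡⟨ nCk+nC[k+1]≡[n+1]C[k+1] n (suc m) ⟩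
  suc n C suc (suc m) ∎

length-concatMap-tabulate : ∀ {A B : Set} (f : Fin n → A) (h : A → List B) →
  length (concatMap h (tabulate f)) ≡ sum (λ i → length (h (f i)))
length-concatMap-tabulate {zero}  f h = refl
length-concatMap-tabulate {suc n} f h =
  trans (length-++ (h (f zero)))
        (cong (_+_ (length (h (f zero)))) (length-concatMap-tabulate (λ i → f (suc i)) h))

length-concatMap-allFin : ∀ {B : Set} (h : Fin n → List B) →
  length (concatMap h (allFin n)) ≡ sum (λ i → length (h i))
length-concatMap-allFin = length-concatMap-tabulate (λ i → i)

length-singleton-if : ∀ {A : Set} b (x : A) → length (if b then x ∷ [] else []) ≡ bcount b
length-singleton-if true  x = refl
length-singleton-if false x = refl

bcount-∧ : ∀ a b → bcount (a ∧ b) ≡ bcount a * bcount b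
bcount-∧ true  b = sym (ℕ.+-identityʳ (bcount b))
bcount-∧ false b = refl

sum-*ˡ : ∀ x (f : Fin n → ℕ) → sum (λ i → x * f i) ≡ x * sum f
sum-*ˡ x f = sym (*-distribˡ-sum x f)

increasingQuadsFrom : ∀ n → Fin n → ℕ
increasingQuadsFrom n i = sum λ j → sum λ k → sum λ l → bcount (lt i j ∧ lt j k ∧ lt k l)

length-quads≡sum : ∀ n → length (quads n) ≡ sum (increasingQuadsFrom n)
length-quads≡sum n =
  trans (length-concatMap-allFin level₁) (sum-cong-≗ λ i →
  trans (length-concatMap-allFin (level₂ i)) (sum-cong-≗ λ j →
  trans (length-concatMap-allFin (level₃ i j)) (sum-cong-≗ λ k →
  trans (length-concatMap-allFin (singleton-if i j k)) (sum-cong-≗ λ l →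
  length-singleton-if (lt i j ∧ lt j k ∧ lt k l) (i , j , k , l)))))
  where
  singleton-if : Fin n → Fin n → Fin n → Fin n → List (Quad n)
  singleton-if i j k l = if lt i j ∧ lt j k ∧ lt k l then (i , j , k , l) ∷ [] else []
  level₃ : Fin n → Fin n → Fin n → List (Quad n)
  level₃ i j k = concatMap (singleton-if i j k) (allFin n)
  level₂ : Fin n → Fin n → List (Quad n)
  level₂ i j = concatMap (level₃ i j) (allFin n)
  level₁ : Fin n → List (Quad n)
  level₁ i = concatMap (level₂ i) (allFin n)

increasingQuadsFrom≡chainsFrom : ∀ n i → increasingQuadsFrom n i ≡ chainsFrom 3 n i
increasingQuadsFrom≡chainsFrom n i = sum-cong-≗ λ j → begin
  (sum λ k → sum λ l → bcount (lt i j ∧ lt j k ∧ lt k l))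
    ≡⟨ sum-cong-≗ (λ k → trans (sum-cong-≗ λ l → bcount-∧₃ (lt i j) (lt j k) (lt k l))
                               (sum-*ˡ₂ (bcount (lt i j)) (bcount (lt j k)) (λ l → bcount (lt k l) * 1))) ⟩
  (sum λ k → bcount (lt i j) * (bcount (lt j k) * chainsFrom 1 n k))
    ≡⟨ sum-*ˡ (bcount (lt i j)) (λ k → bcount (lt j k) * chainsFrom 1 n k) ⟩
  bcount (lt i j) * chainsFrom 2 n j ∎
  where
  bcount-∧₃ : ∀ a b c → bcount (a ∧ b ∧ c) ≡ bcount a * (bcount b * (bcount c * 1))
  bcount-∧₃ a b c = trans (bcount-∧ a (b ∧ c)) (cong (bcount a *_)
    (trans (bcount-∧ b c) (cong (bcount b *_) (sym (ℕ.*-identityʳ (bcount c))))))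
  sum-*ˡ₂ : ∀ x y (f : Fin n → ℕ) → sum (λ l → x * (y * f l)) ≡ x * (y * sum f)
  sum-*ˡ₂ x y f = trans (sum-*ˡ x (λ l → y * f l)) (cong (x *_) (sum-*ˡ y f))

length-quads : ∀ n → length (quads n) ≡ n C 4
length-quads n = begin
  length (quads n)            ≡⟨ length-quads≡sum n ⟩
  sum (increasingQuadsFrom n) ≡⟨ sum-cong-≗ (increasingQuadsFrom≡chainsFrom n) ⟩
  chains 3 n                  ≡⟨ chains≡C 3 n ⟩
  n C 4                       ∎

Increasing : Quad n → Set
Increasing (i , j , k , l) = i < j × j < k × k < l

concatMap-all : ∀ {A B : Set} {P : B → Set} (h : A → List B) →
  (∀ x → All P (h x)) → ∀ xs → All P (concatMap h xs)
concatMap-all h all-h xs = concat⁺ (map⁺ (All.universal all-h xs))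

singleton-if-all : ∀ {A : Set} {P : A → Set} b {x : A} → (T b → P x) →
  All P (if b then x ∷ [] else [])
singleton-if-all true  Px = Px tt ∷ []
singleton-if-all false Px = []

quads-increasing : ∀ n → All Increasing (quads n)
quads-increasing n =
  concatMap-all _ (λ i → concatMap-all _ (λ j → concatMap-all _ (λ k → concatMap-all _
    (singleton-if-increasing i j k) (allFin n)) (allFin n)) (allFin n)) (allFin n)
  where
  singleton-if-increasing : ∀ i j k l →
    All Increasing (if lt i j ∧ lt j k ∧ lt k l then (i , j , k , l) ∷ [] else [])
  singleton-if-increasing i j k l = singleton-if-all (lt i j ∧ lt j k ∧ lt k l) λ t →
    let (i<j , j<k∧k<l) = Equivalence.to (T-∧ {lt i j}) t
        (j<k , k<l)     = Equivalence.to (T-∧ {lt j k}) j<k∧k<l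
    in lt⇒< i j i<j , lt⇒< j k j<k , lt⇒< k l k<l

StrictlyIncreasing : (Fin m → Fin n) → Set
StrictlyIncreasing v = ∀ {r c} → r < c → v r < v c

qvert-increasing : {q : Quad n} → Increasing q → StrictlyIncreasing (qvert q)
qvert-increasing (i<j , j<k , k<l) {zero}                 {suc zero}             _ = i<j
qvert-increasing (i<j , j<k , k<l) {zero}                 {suc (suc zero)}       _ = <-trans i<j j<k
qvert-increasing (i<j , j<k , k<l) {zero}                 {suc (suc (suc zero))} _ = <-trans i<j (<-trans j<k k<l)
qvert-increasing (i<j , j<k , k<l) {suc zero}             {suc (suc zero)}       _ = j<k
qvert-increasing (i<j , j<k , k<l) {suc zero}             {suc (suc (suc zero))} _ = <-trans j<k k<l
qvert-increasing (i<j , j<k , k<l) {suc (suc zero)}       {suc (suc (suc zero))} _ = k<l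
qvert-increasing _                 {_}                    {zero}                 ()
qvert-increasing _                 {suc zero}             {suc zero}             (s≤s ())
qvert-increasing _                 {suc (suc zero)}       {suc zero}             (s≤s ())
qvert-increasing _                 {suc (suc zero)}       {suc (suc zero)}       (s≤s (s≤s ()))
qvert-increasing _                 {suc (suc (suc zero))} {suc zero}             (s≤s ())
qvert-increasing _                 {suc (suc (suc zero))} {suc (suc zero)}       (s≤s (s≤s ()))
qvert-increasing _                 {suc (suc (suc zero))} {suc (suc (suc zero))} (s≤s (s≤s (s≤s ())))

sign : Bool → ℤ
sign true  = + 1
sign false = -1ℤ

seidel-diagonal : (T : Tournament n) (x : Fin n) → seidel T x x ≡ + 0
seidel-diagonal T x rewrite irrefl T x = refl

seidel-sign : (T : Tournament n) {x y : Fin n} → x ≢ y → seidel T x y ≡ sign (dom T x y)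
seidel-sign T {x} {y} x≢y rewrite antisym T x y x≢y with dom T x y
... | true  = refl
... | false = refl

seidel-sign-flip : (T : Tournament n) {x y : Fin n} → x ≢ y → seidel T y x ≡ ℤ.- sign (dom T x y)
seidel-sign-flip T {x} {y} x≢y rewrite antisym T x y x≢y with dom T x y
... | true  = refl
... | false = refl

skew : (Fin m → Fin m → Bool) → Fin m → Fin m → ℤ
skew E r c with <-cmp r c
... | tri< _ _ _ = sign (E r c)
... | tri≈ _ _ _ = + 0
... | tri> _ _ _ = ℤ.- sign (E c r)

seidel-skew : (T : Tournament n) {v : Fin m → Fin n} → StrictlyIncreasing v →
  ∀ r c → seidel T (v r) (v c) ≡ skew (λ r c → dom T (v r) (v c)) r c
seidel-skew T {v} v-inc r c with <-cmp r c
... | tri< r<c _ _ = seidel-sign T (<⇒≢ (v-inc r<c))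
... | tri≈ _ refl _ = seidel-diagonal T (v r)
... | tri> _ _ c<r = seidel-sign-flip T (<⇒≢ (v-inc c<r))

ΣFin-cong : ∀ n {f g : Fin n → ℤ} → (∀ i → f i ≡ g i) → ΣFin n f ≡ ΣFin n g
ΣFin-cong zero    f≗g = refl
ΣFin-cong (suc n) f≗g = cong₂ ℤ._+_ (f≗g zero) (ΣFin-cong n (λ i → f≗g (suc i)))

det-cong : ∀ n {M N : Fin n → Fin n → ℤ} → (∀ r c → M r c ≡ N r c) → det n M ≡ det n N
det-cong zero    M≗N = refl
det-cong (suc n) M≗N = ΣFin-cong (suc n) λ j →
  cong₂ ℤ._*_ (cong (sgn (toℕ j) ℤ.*_) (M≗N zero j))
              (det-cong n (λ r c → M≗N (suc r) (punchIn j c)))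

-- Only the entries above the diagonal matter: skew never reads the others.
upper : (a b c d e f : Bool) → Fin 4 → Fin 4 → Bool
upper a b c d e f zero       (suc zero)             = a
upper a b c d e f zero       (suc (suc zero))       = b
upper a b c d e f zero       (suc (suc (suc zero))) = c
upper a b c d e f (suc zero) (suc (suc zero))       = d
upper a b c d e f (suc zero) (suc (suc (suc zero))) = e
upper a b c d e f (suc (suc zero)) (suc (suc (suc zero))) = f
upper a b c d e f _          _                      = false

cycle3 : (xy yz xz : Bool) → Bool
cycle3 xy yz xz = (xy ∧ yz ∧ not xz) ∨ (xz ∧ not yz ∧ not xy)

cycles4 : (a b c d e f : Bool) → ℕ
cycles4 a b c d e f =
  bcount (cycle3 a d b) + bcount (cycle3 a e c) + bcount (cycle3 b f c) + bcount (cycle3 d f e)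

∀-Bool? : {P : Bool → Set} → (∀ b → Dec (P b)) → Dec (∀ b → P b)
∀-Bool? {P} P? = map′ both (λ h → h true , h false) (P? true ×-dec P? false)
  where
  both : P true × P false → ∀ b → P b
  both (t , f) true  = t
  both (t , f) false = f

det-skew-upper : ∀ a b c d e f →
  det 4 (skew (upper a b c d e f)) ≡ + (8 * bcount (does (cycles4 a b c d e f ℕ.≟ 1)) + 1)
det-skew-upper = from-yes
  (∀-Bool? λ a → ∀-Bool? λ b → ∀-Bool? λ c → ∀-Bool? λ d → ∀-Bool? λ e → ∀-Bool? λ f →
     det 4 (skew (upper a b c d e f)) ℤ.≟ + (8 * bcount (does (cycles4 a b c d e f ℕ.≟ 1)) + 1))

cyclic-increasing : (T : Tournament n) {x y z : Fin n} → x < y → y < z →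
  cyclic T x y z ≡ cycle3 (dom T x y) (dom T y z) (dom T x z)
cyclic-increasing T {x} {y} {z} x<y y<z
  rewrite antisym T x z (<⇒≢ (<-trans x<y y<z))
        | antisym T y z (<⇒≢ y<z)
        | antisym T x y (<⇒≢ x<y) = refl

threeCycles-increasing : (T : Tournament n) {q : Quad n} → Increasing q →
  let (i , j , k , l) = q in
  threeCycles T q ≡ cycles4 (dom T i j) (dom T i k) (dom T i l) (dom T j k) (dom T j l) (dom T k l)
threeCycles-increasing T (i<j , j<k , k<l) =
  cong₂ _+_ (cong₂ _+_ (cong₂ _+_ (cong bcount (cyclic-increasing T i<j j<k))
                                  (cong bcount (cyclic-increasing T i<j (<-trans j<k k<l))))
                       (cong bcount (cyclic-increasing T (<-trans i<j j<k) k<l)))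
            (cong bcount (cyclic-increasing T j<k k<l))

principalMinor4-increasing : (T : Tournament n) {q : Quad n} → Increasing q →
  principalMinor4 T q ≡ + (8 * bcount (isDiamond T q) + 1)
principalMinor4-increasing T {q@(i , j , k , l)} q-inc = begin
  principalMinor4 T q
    ≡⟨ det-cong 4 (seidel-skew T (qvert-increasing q-inc)) ⟩
  det 4 (skew (upper a b c d e f))
    ≡⟨ det-skew-upper a b c d e f ⟩
  + (8 * bcount (does (cycles4 a b c d e f ℕ.≟ 1)) + 1)
    ≡⟨ cong (λ t → + (8 * bcount (does (t ℕ.≟ 1)) + 1)) (threeCycles-increasing T q-inc) ⟨
  + (8 * bcount (isDiamond T q) + 1) ∎
  where
  a = dom T i j
  b = dom T i k
  c = dom T i l
  d = dom T j k
  e = dom T j l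
  f = dom T k l

sum-map-affine : ∀ {A : Set} k (f : A → ℤ) (g : A → ℕ) {xs : List A} →
  All (λ x → f x ≡ + (k * g x + 1)) xs →
  foldr ℤ._+_ (+ 0) (map f xs) ≡ + (k * foldr _+_ 0 (map g xs) + length xs)
sum-map-affine k f g {[]}     []           = cong +_ (sym (trans (ℕ.+-identityʳ (k * 0)) (ℕ.*-zeroʳ k)))
sum-map-affine k f g {x ∷ xs} (fx≡ ∷ fxs≡) = begin
  f x ℤ.+ foldr ℤ._+_ (+ 0) (map f xs)
    ≡⟨ cong₂ ℤ._+_ fx≡ (sum-map-affine k f g fxs≡) ⟩
  + (k * g x + 1) ℤ.+ + (k * S + length xs)
    ≡⟨ ℤ.pos-+ (k * g x + 1) (k * S + length xs) ⟨
  + ((k * g x + 1) + (k * S + length xs))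
    ≡⟨ cong +_ (affine k (g x) S (length xs)) ⟩
  + (k * (g x + S) + suc (length xs)) ∎
  where
  S = foldr _+_ 0 (map g xs)
  affine : ∀ k y s l → (k * y + 1) + (k * s + l) ≡ k * (y + s) + suc l
  affine = solve-∀

lemma1 : (n : ℕ) (T : Tournament n) →
    sumPrincipalMinors4 T ≡ + (8 Data.Nat.* diamonds T Data.Nat.+ n C 4)
lemma1 n T = begin
  sumPrincipalMinors4 T
    ≡⟨ sum-map-affine 8 (principalMinor4 T) (λ q → bcount (isDiamond T q))
         (All.map (principalMinor4-increasing T) (quads-increasing n)) ⟩
  + (8 * diamonds T + length (quads n))
    ≡⟨ cong (λ m → + (8 * diamonds T + m)) (length-quads n) ⟩
  + (8 * diamonds T + n C 4) ∎
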